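{- For every positive integer $m$, let $$g_m=\min_{A\in \mathcal{K}_m}\left\{ m^{ -1}\sum_{n\in \mathbb{Z}_m}\delta_A(n)\right\},$$ where $\mathcal{K}_m$ is the set of subsets $A\subseteq \mathbb{Z}_m$ such that $\delta_A(n)\geq 1$ for all $n\in\mathbb{Z}_m$. Then $$\limsup_{m\rightarrow\infty}g_m\leq 2.$$
   Context: For a positive integer $m$, $\mathbb{Z}_m$ denotes the set of residue classes modulo $m$. For $A\subseteq\mathbb{Z}_m$ and $n\in\mathbb{Z}_m$, $\delta_A(n)$ denotes the number of ordered pairs $(x,y)$ with $x,y\in A$ and $n=x-y$ in $\mathbb{Z}_m$. -}

module Defs where

open import Data.Nat using (ℕ; zero; suc; _+_; _*_; _∸_; _≤_; _≟_; NonZero)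
open import Data.Nat.DivMod using (_%_)
open import Data.Fin using (Fin; toℕ)
open import Data.Fin.Subset using (Subset; inside; outside)
open import Data.Vec using (lookup)
open import Data.List using (List; map; allFin)
open import Data.Nat.ListAction using (sum)
open import Data.Bool using (Bool; true; false; _∧_)
open import Relation.Nullary using (does)

-- Z_m is represented by Fin m (residues 0 .. m-1).
-- The residue of x - y modulo m, as a natural number in [0, m).
diffℕ : (m : ℕ) .{{_ : NonZero m}} → Fin m → Fin m → ℕ
diffℕ m x y = (toℕ x + (m ∸ toℕ y)) % m

ind : Bool → ℕ
ind true  = 1
ind false = 0

δ : (m : ℕ) .{{_ : NonZero m}} → Subset m → Fin m → ℕ
δ m A n =
  sum (map (λ x → sum (map (λ y →
        ind (lookup A x ∧ lookup A y ∧ does (diffℕ m x y ≟ toℕ n)))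
      (allFin m))) (allFin m))

Σδ : (m : ℕ) .{{_ : NonZero m}} → Subset m → ℕ
Σδ m A = sum (map (δ m A) (allFin m))

InK : (m : ℕ) .{{_ : NonZero m}} → Subset m → Set
InK m A = (n : Fin m) → 1 ≤ δ m A n

{-# OPTIONS --safe #-}
-- Choose s with 2s² ≤ m < 2(s+1)² and take A = {0, …, s−1} ∪ {0, s, 2s, …, (s+2)s}.
-- Every n ≤ (s+2)s is a difference js − i with i < s, and since m ≤ 2(s+2)s + 1 every
-- other residue is the negative of such a difference, so A ∈ K_m. Then
-- Σ_n δ_A(n) ≤ |A|² ≤ (2s+3)², which is 2m(1 + O(1/s)).
module Submission where

open import Defs
open import Data.Nat using (ℕ; zero; suc; _+_; _*_; _∸_; _≤_; _<_; _≟_; _≤?_; _<?_; NonZero; >-nonZero; z≤n; s≤s; z<s; s≤s⁻¹)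
open import Data.Nat.Properties
open import Data.Nat.DivMod using (_%_; [m+n]%n≡m%n; m<n⇒m%n≡m)
open import Data.Nat.Tactic.RingSolver using (solve-∀)
open import Data.Bool using (Bool; true; false; _∧_; _∨_)
open import Data.Fin using (Fin; zero; suc; toℕ; fromℕ<)
open import Data.Fin.Properties using (toℕ<n; toℕ-fromℕ<)
open import Data.Fin.Subset using (Subset; ∣_∣)
open import Data.Vec using ([]; _∷_; lookup)
import Data.Vec as Vec
open import Data.Vec.Properties using (lookup∘tabulate)
open import Data.List using (List; []; _∷_; map; allFin; tabulate; length; upTo; _++_)
open import Data.List.Properties using (map-tabulate; length-++; length-map; length-applyUpTo)
open import Data.List.Membership.Propositional using (_∈_)
open import Data.List.Membership.Propositional.Properties using (∈-map⁺; ∈-++⁺ˡ; ∈-++⁺ʳ; ∈-upTo⁺)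
open import Data.List.Membership.DecPropositional _≟_ using (_∈?_)
open import Data.List.Relation.Unary.All as All using (All)
open import Data.List.Relation.Unary.All.Properties using (++⁺; map⁺; applyUpTo⁺₁)
open import Data.Nat.ListAction using (sum)
open import Algebra.Properties.Semiring.Sum +-*-semiring
  using (sum-syntax; sum-cong-≗; sum-replicate-zero; ∑-distrib-+; ∑-comm; *-distribˡ-sum; *-distribʳ-sum)
  renaming (sum to ∑)
open import Data.Product using (Σ; ∃-syntax; ∃₂; _×_; _,_)
open import Function using (_∘_; id; mk⇔)
open import Relation.Nullary using (does; yes; no)
open import Relation.Nullary.Decidable using (dec-true; does-⇔)
open import Relation.Binary.PropositionalEquality

sum-tabulate : ∀ {m} (f : Fin m → ℕ) → sum (tabulate f) ≡ ∑ f
sum-tabulate {zero}  f = refl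
sum-tabulate {suc m} f = cong (f zero +_) (sum-tabulate (f ∘ suc))

sum-map-allFin : ∀ {m} (f : Fin m → ℕ) → sum (map f (allFin m)) ≡ ∑ f
sum-map-allFin f = trans (cong sum (map-tabulate id f)) (sum-tabulate f)

∑-mono-≤ : ∀ {m} {f g : Fin m → ℕ} → (∀ i → f i ≤ g i) → ∑ f ≤ ∑ g
∑-mono-≤ {zero}  f≤g = z≤n
∑-mono-≤ {suc m} f≤g = +-mono-≤ (f≤g zero) (∑-mono-≤ (f≤g ∘ suc))

term≤∑ : ∀ {m} (f : Fin m → ℕ) i → f i ≤ ∑ f
term≤∑ f zero    = m≤m+n _ _
term≤∑ f (suc i) = ≤-trans (term≤∑ (f ∘ suc) i) (m≤n+m _ _)

ind-∨ : ∀ a b → ind (a ∨ b) ≤ ind a + ind b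
ind-∨ false b = ≤-refl
ind-∨ true  b = s≤s z≤n

∑-ind-≟≤1 : ∀ m d → ∑[ n < m ] ind (does (d ≟ toℕ n)) ≤ 1
∑-ind-≟≤1 zero    d       = z≤n
∑-ind-≟≤1 (suc m) zero    = s≤s (≤-reflexive (sum-replicate-zero m))
∑-ind-≟≤1 (suc m) (suc d) = ∑-ind-≟≤1 m d

∑-ind-∧-≤ : ∀ m a b d → ∑[ n < m ] ind (a ∧ b ∧ does (d ≟ toℕ n)) ≤ ind a * ind b
∑-ind-∧-≤ m false b     d = ≤-reflexive (sum-replicate-zero m)
∑-ind-∧-≤ m true  false d = ≤-reflexive (sum-replicate-zero m)
∑-ind-∧-≤ m true  true  d = ∑-ind-≟≤1 m d

∣p∣≡∑ind : ∀ {m} (p : Subset m) → ∣ p ∣ ≡ ∑[ x < m ] ind (lookup p x)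
∣p∣≡∑ind []           = refl
∣p∣≡∑ind (false ∷ p) = ∣p∣≡∑ind p
∣p∣≡∑ind (true  ∷ p) = cong suc (∣p∣≡∑ind p)

module _ (m : ℕ) .{{_ : NonZero m}} (A : Subset m) where

  pairs : Fin m → Fin m → Fin m → ℕ
  pairs n x y = ind (lookup A x ∧ lookup A y ∧ does (diffℕ m x y ≟ toℕ n))

  δ≡∑∑pairs : ∀ n → δ m A n ≡ ∑[ x < m ] ∑[ y < m ] pairs n x y
  δ≡∑∑pairs n = trans (sum-map-allFin {m} _) (sum-cong-≗ (λ x → sum-map-allFin {m} (pairs n x)))

  δ≥1 : ∀ {n} x y → lookup A x ≡ true → lookup A y ≡ true → diffℕ m x y ≡ toℕ n → 1 ≤ δ m A n
  δ≥1 {n} x y x∈A y∈A x-y≡n = begin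
    1                                   ≡⟨ sym counted ⟩
    pairs n x y                         ≤⟨ term≤∑ (pairs n x) y ⟩
    ∑[ y < m ] pairs n x y              ≤⟨ term≤∑ (λ x → ∑[ y < m ] pairs n x y) x ⟩
    ∑[ x < m ] ∑[ y < m ] pairs n x y   ≡⟨ sym (δ≡∑∑pairs n) ⟩
    δ m A n                             ∎
    where
      open ≤-Reasoning
      counted : pairs n x y ≡ 1
      counted rewrite x∈A | y∈A | x-y≡n | dec-true (toℕ n ≟ toℕ n) refl = refl

  Σδ≤∣A∣² : Σδ m A ≤ ∣ A ∣ * ∣ A ∣
  Σδ≤∣A∣² = begin
    Σδ m A                                              ≡⟨ sum-map-allFin (δ m A) ⟩
    ∑[ n < m ] δ m A n                                  ≡⟨ sum-cong-≗ δ≡∑∑pairs ⟩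
    ∑[ n < m ] ∑[ x < m ] ∑[ y < m ] pairs n x y        ≡⟨ ∑-comm (λ n x → ∑[ y < m ] pairs n x y) ⟩
    ∑[ x < m ] ∑[ n < m ] ∑[ y < m ] pairs n x y        ≡⟨ sum-cong-≗ (λ x → ∑-comm (λ n y → pairs n x y)) ⟩
    ∑[ x < m ] ∑[ y < m ] ∑[ n < m ] pairs n x y        ≤⟨ ∑-mono-≤ (λ x → ∑-mono-≤ (λ y →
                                                             ∑-ind-∧-≤ m (a x) (a y) (diffℕ m x y))) ⟩
    ∑[ x < m ] ∑[ y < m ] (ind (a x) * ind (a y))       ≡⟨ sum-cong-≗ (λ x → sym (*-distribˡ-sum (ind (a x)) (ind ∘ a))) ⟩
    ∑[ x < m ] (ind (a x) * ∑ (ind ∘ a))                ≡⟨ sym (*-distribʳ-sum (∑ (ind ∘ a)) (ind ∘ a)) ⟩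
    ∑ (ind ∘ a) * ∑ (ind ∘ a)                           ≡⟨ sym (cong₂ _*_ (∣p∣≡∑ind A) (∣p∣≡∑ind A)) ⟩
    ∣ A ∣ * ∣ A ∣                                       ∎
    where
      open ≤-Reasoning
      a : Fin m → Bool
      a = lookup A

fromList : (m : ℕ) → List ℕ → Subset m
fromList m L = Vec.tabulate (λ x → does (toℕ x ∈? L))

∈⇒∈fromList : ∀ {m L x} (x<m : x < m) → x ∈ L → lookup (fromList m L) (fromℕ< x<m) ≡ true
∈⇒∈fromList {L = L} x<m x∈L =
  trans (lookup∘tabulate _ (fromℕ< x<m)) (dec-true (_ ∈? L) (subst (_∈ L) (sym (toℕ-fromℕ< x<m)) x∈L))

∑-ind-∈?≤length : ∀ m L → ∑[ x < m ] ind (does (toℕ x ∈? L)) ≤ length L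
∑-ind-∈?≤length m []      = ≤-reflexive (sum-replicate-zero m)
∑-ind-∈?≤length m (d ∷ L) = begin
  ∑[ x < m ] ind (does (toℕ x ≟ d) ∨ does (toℕ x ∈? L))          ≤⟨ ∑-mono-≤ {m} (λ x → ind-∨ (does (toℕ x ≟ d)) _) ⟩
  ∑[ x < m ] (ind (does (toℕ x ≟ d)) + ind (does (toℕ x ∈? L)))  ≡⟨ ∑-distrib-+ {m} _ _ ⟩
  ∑[ x < m ] ind (does (toℕ x ≟ d)) + ∑[ x < m ] ind (does (toℕ x ∈? L))
    ≡⟨ cong (_+ _) (sum-cong-≗ {m} (λ x → cong ind (does-⇔ (mk⇔ sym sym) (toℕ x ≟ d) (d ≟ toℕ x)))) ⟩
  ∑[ x < m ] ind (does (d ≟ toℕ x)) + ∑[ x < m ] ind (does (toℕ x ∈? L))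
    ≤⟨ +-mono-≤ (∑-ind-≟≤1 m d) (∑-ind-∈?≤length m L) ⟩
  suc (length L)                                                  ∎
  where open ≤-Reasoning

∣fromList∣≤length : ∀ m L → ∣ fromList m L ∣ ≤ length L
∣fromList∣≤length m L = begin
  ∣ fromList m L ∣                           ≡⟨ ∣p∣≡∑ind (fromList m L) ⟩
  ∑[ x < m ] ind (lookup (fromList m L) x)   ≡⟨ sum-cong-≗ {m} (λ x → cong ind (lookup∘tabulate _ x)) ⟩
  ∑[ x < m ] ind (does (toℕ x ∈? L))         ≤⟨ ∑-ind-∈?≤length m L ⟩
  length L                                   ∎
  where open ≤-Reasoning

n+y≡x⇒[x+[m∸y]]%m≡n : ∀ {m n x y} .{{_ : NonZero m}} → n < m → y ≤ m → n + y ≡ x → (x + (m ∸ y)) % m ≡ n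
n+y≡x⇒[x+[m∸y]]%m≡n {m} {n} {y = y} n<m y≤m refl = begin
  (n + y + (m ∸ y)) % m    ≡⟨ cong (_% m) (+-assoc n y (m ∸ y)) ⟩
  (n + (y + (m ∸ y))) % m  ≡⟨ cong (λ z → (n + z) % m) (m+[n∸m]≡n y≤m) ⟩
  (n + m) % m              ≡⟨ [m+n]%n≡m%n n m ⟩
  n % m                    ≡⟨ m<n⇒m%n≡m n<m ⟩
  n                        ∎
  where open ≡-Reasoning

[m∸n]+y≡x⇒[y+[m∸x]]%m≡n : ∀ {m n x y} .{{_ : NonZero m}} → n < m → x ≤ m → m ∸ n + y ≡ x → (y + (m ∸ x)) % m ≡ n
[m∸n]+y≡x⇒[y+[m∸x]]%m≡n {m} {n} {y = y} n<m x≤m refl = begin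
  (y + (m ∸ (m ∸ n + y))) % m  ≡⟨ cong (λ z → (y + z) % m) (sym (∸-+-assoc m (m ∸ n) y)) ⟩
  (y + (m ∸ (m ∸ n) ∸ y)) % m  ≡⟨ cong (λ z → (y + (z ∸ y)) % m) (m∸[m∸n]≡n (<⇒≤ n<m)) ⟩
  (y + (n ∸ y)) % m            ≡⟨ cong (_% m) (m+[n∸m]≡n y≤n) ⟩
  n % m                        ≡⟨ m<n⇒m%n≡m n<m ⟩
  n                            ∎
  where
    open ≡-Reasoning
    y≤n : y ≤ n
    y≤n = +-cancelˡ-≤ (m ∸ n) y n (subst (m ∸ n + y ≤_) (sym (m∸n+n≡m (<⇒≤ n<m))) x≤m)

DifferenceCover : List ℕ → ℕ → Set
DifferenceCover L t = ∀ {n} → n ≤ t → ∃₂ λ x y → x ∈ L × y ∈ L × n + y ≡ x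

δ-fromList≥1 : ∀ m .{{_ : NonZero m}} {L n x y} → All (_< m) L → x ∈ L → y ∈ L →
               (x + (m ∸ y)) % m ≡ toℕ n → 1 ≤ δ m (fromList m L) n
δ-fromList≥1 m {L} L<m x∈L y∈L x-y≡n =
  δ≥1 m (fromList m L) (fromℕ< x<m) (fromℕ< y<m) (∈⇒∈fromList x<m x∈L) (∈⇒∈fromList y<m y∈L)
    (trans (cong₂ (λ a b → (a + (m ∸ b)) % m) (toℕ-fromℕ< x<m) (toℕ-fromℕ< y<m)) x-y≡n)
  where
    x<m = All.lookup L<m x∈L
    y<m = All.lookup L<m y∈L

InK-fromList : ∀ m .{{_ : NonZero m}} {L t} → All (_< m) L → DifferenceCover L t → m ≤ suc (t + t) →
               InK m (fromList m L)
InK-fromList m {L} {t} L<m cover m≤2t+1 n with toℕ n ≤? t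
... | yes n≤t =
  let x , y , x∈L , y∈L , n+y≡x = cover n≤t
  in δ-fromList≥1 m L<m x∈L y∈L (n+y≡x⇒[x+[m∸y]]%m≡n (toℕ<n n) (<⇒≤ (All.lookup L<m y∈L)) n+y≡x)
... | no n≰t =
  let x , y , x∈L , y∈L , m∸n+y≡x = cover m∸n≤t
  in δ-fromList≥1 m L<m y∈L x∈L ([m∸n]+y≡x⇒[y+[m∸x]]%m≡n (toℕ<n n) (<⇒≤ (All.lookup L<m x∈L)) m∸n+y≡x)
  where
    m∸n≤t : m ∸ toℕ n ≤ t
    m∸n≤t = m≤n+o⇒m∸n≤o m (toℕ n) (≤-trans m≤2t+1 (+-monoˡ-≤ t (≰⇒> n≰t)))

round-up : ∀ s .{{_ : NonZero s}} n → ∃₂ λ j i → i < s × n + i ≡ j * s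
round-up s@(suc w) zero    = 0 , 0 , z<s , refl
round-up s@(suc w) (suc n) with round-up s n
... | j , suc i , i<s , n+i≡js = j , i , <⇒≤ i<s , trans (sym (+-suc n i)) n+i≡js
... | j , zero  , _   , n≡js   = suc j , w , ≤-refl , cong suc (begin
  n + w       ≡⟨ cong (_+ w) (trans (sym (+-identityʳ n)) n≡js) ⟩
  j * s + w   ≡⟨ +-comm (j * s) w ⟩
  w + j * s   ∎)
  where open ≡-Reasoning

blocks : ℕ → ℕ → List ℕ
blocks s r = upTo s ++ map (_* s) (upTo (suc r))

length-blocks : ∀ s r → length (blocks s r) ≡ s + suc r
length-blocks s r = begin
  length (blocks s r)                                      ≡⟨ length-++ (upTo s) ⟩
  length (upTo s) + length (map (_* s) (upTo (suc r)))     ≡⟨ cong₂ _+_ (length-applyUpTo id s)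
                                                               (trans (length-map (_* s) (upTo (suc r))) (length-applyUpTo id (suc r))) ⟩
  s + suc r                                                ∎
  where open ≡-Reasoning

blocks-bounded : ∀ {m} s r → s ≤ m → r * s < m → All (_< m) (blocks s r)
blocks-bounded s r s≤m rs<m = ++⁺
  (applyUpTo⁺₁ id s (λ i<s → <-≤-trans i<s s≤m))
  (map⁺ (applyUpTo⁺₁ id (suc r) (λ j<1+r → ≤-<-trans (*-monoˡ-≤ s (s≤s⁻¹ j<1+r)) rs<m)))

blocks-cover : ∀ s .{{_ : NonZero s}} r → DifferenceCover (blocks s r) (r * s)
blocks-cover s r {n} n≤rs with j , i , i<s , n+i≡js ← round-up s n =
  j * s , i , ∈-++⁺ʳ (upTo s) (∈-map⁺ (_* s) (∈-upTo⁺ j<1+r)) , ∈-++⁺ˡ (∈-upTo⁺ i<s) , n+i≡js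
  where
    j<1+r : j < suc r
    j<1+r = *-cancelʳ-< s j (suc r) (begin-strict
      j * s      ≡⟨ n+i≡js ⟨
      n + i      <⟨ +-mono-≤-< n≤rs i<s ⟩
      r * s + s  ≡⟨ +-comm (r * s) s ⟩
      suc r * s  ∎)
      where open ≤-Reasoning

strictly-increasing-bracket : (f : ℕ → ℕ) → f 0 ≡ 0 → (∀ s → f s < f (suc s)) →
                              ∀ m → ∃[ s ] f s ≤ m × m < f (suc s)
strictly-increasing-bracket f f0≡0 f-inc zero = 0 , ≤-reflexive f0≡0 , subst (_< f 1) f0≡0 (f-inc 0)
strictly-increasing-bracket f f0≡0 f-inc (suc m)
  with s , fs≤m , m<f[1+s] ← strictly-increasing-bracket f f0≡0 f-inc m
     | suc m <? f (suc s)
... | yes 1+m<f[1+s] = s , m≤n⇒m≤1+n fs≤m , 1+m<f[1+s]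
... | no  1+m≮f[1+s] = suc s , f[1+s]≤1+m , subst (_< f (suc (suc s))) f[1+s]≡1+m (f-inc (suc s))
  where
    f[1+s]≤1+m = ≮⇒≥ 1+m≮f[1+s]
    f[1+s]≡1+m = ≤-antisym f[1+s]≤1+m m<f[1+s]

2*s²<2*[1+s]² : ∀ s → 2 * (s * s) < 2 * (suc s * suc s)
2*s²<2*[1+s]² s = *-monoʳ-< 2 (*-mono-< (n<1+n s) (n<1+n s))

[2+s]*s<2*s² : ∀ s → 2 < s → (2 + s) * s < 2 * (s * s)
[2+s]*s<2*s² s 2<s = begin-strict
  (2 + s) * s    ≡⟨ *-distribʳ-+ s 2 s ⟩
  2 * s + s * s  <⟨ +-monoˡ-< (s * s) (*-monoˡ-< s 2<s) ⟩
  s * s + s * s  ≡⟨ cong (s * s +_) (+-identityʳ (s * s)) ⟨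
  2 * (s * s)    ∎
  where
    open ≤-Reasoning
    instance
      s≢0 : NonZero s
      s≢0 = >-nonZero (<-trans z<s 2<s)

2*[1+s]²≡2+2*[2+s]*s : ∀ s → 2 * (suc s * suc s) ≡ suc (suc ((2 + s) * s + (2 + s) * s))
2*[1+s]²≡2+2*[2+s]*s = solve-∀

[1+k]*[2s+3]²≤[2k+3]*2s² : ∀ k s → 12 * suc k ≤ s →
                           suc k * ((s + (3 + s)) * (s + (3 + s))) ≤ (2 * suc k + 1) * (2 * (s * s))
[1+k]*[2s+3]²≤[2k+3]*2s² k s 12[1+k]≤s with u , refl ← m≤n⇒∃[o]m+o≡n 12[1+k]≤s =
  ≤-trans (m≤m+n _ _) (≤-reflexive (sym (identity k u)))
  where
    identity : ∀ k u → let s = 12 * suc k + u in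
      (2 * suc k + 1) * (2 * (s * s))
        ≡ suc k * ((s + (3 + s)) * (s + (3 + s))) + (suc k * (144 * k + 135 + 12 * u) + 2 * u * s)
    identity = solve-∀

blocks-witness : ∀ k m .{{_ : NonZero m}} s → 12 * suc k ≤ s → 2 * (s * s) ≤ m → m < 2 * (suc s * suc s) →
                 Σ (Subset m) (λ A → InK m A × (suc k * Σδ m A ≤ (2 * suc k + 1) * m))
blocks-witness k m s 12[1+k]≤s 2s²≤m m<2[1+s]² = A , InK-fromList m bounded (blocks-cover s (2 + s)) m≤2t+1 , weight
  where
    instance
      s≢0 : NonZero s
      s≢0 = >-nonZero (<-≤-trans z<s 12[1+k]≤s)
    A = fromList m (blocks s (2 + s))
    t = (2 + s) * s

    t<m : t < m
    t<m = <-≤-trans ([2+s]*s<2*s² s (≤-trans 3≤12 (≤-trans (m≤m*n 12 (suc k)) 12[1+k]≤s))) 2s²≤m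
      where
        3≤12 : 3 ≤ 12
        3≤12 = s≤s (s≤s (s≤s z≤n))

    bounded : All (_< m) (blocks s (2 + s))
    bounded = blocks-bounded s (2 + s) (≤-trans (m≤n*m s (2 + s)) (<⇒≤ t<m)) t<m

    m≤2t+1 : m ≤ suc (t + t)
    m≤2t+1 = s≤s⁻¹ (subst (m <_) (2*[1+s]²≡2+2*[2+s]*s s) m<2[1+s]²)

    ∣A∣≤2s+3 : ∣ A ∣ ≤ s + (3 + s)
    ∣A∣≤2s+3 = subst (∣ A ∣ ≤_) (length-blocks s (2 + s)) (∣fromList∣≤length m (blocks s (2 + s)))

    weight : suc k * Σδ m A ≤ (2 * suc k + 1) * m
    weight = begin
      suc k * Σδ m A                            ≤⟨ *-monoʳ-≤ (suc k) (Σδ≤∣A∣² m A) ⟩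
      suc k * (∣ A ∣ * ∣ A ∣)                   ≤⟨ *-monoʳ-≤ (suc k) (*-mono-≤ ∣A∣≤2s+3 ∣A∣≤2s+3) ⟩
      suc k * ((s + (3 + s)) * (s + (3 + s)))   ≤⟨ [1+k]*[2s+3]²≤[2k+3]*2s² k s 12[1+k]≤s ⟩
      (2 * suc k + 1) * (2 * (s * s))           ≤⟨ *-monoʳ-≤ (2 * suc k + 1) 2s²≤m ⟩
      (2 * suc k + 1) * m                       ∎
      where open ≤-Reasoning

theorem2 : (k : ℕ) → ∃[ M ] ((m : ℕ) .{{_ : NonZero m}} → M ≤ m →
             Σ (Subset m) (λ A → InK m A × (suc k * Σδ m A ≤ (2 * suc k + 1) * m)))
theorem2 k = 2 * (K * K) , λ m 2K²≤m →
  let s , 2s²≤m , m<2[1+s]² = strictly-increasing-bracket (λ s → 2 * (s * s)) refl 2*s²<2*[1+s]² m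
      K≤s = ≮⇒≥ λ s<K → <⇒≱ m<2[1+s]² (≤-trans (*-monoʳ-≤ 2 (*-mono-≤ s<K s<K)) 2K²≤m)
  in blocks-witness k m s K≤s 2s²≤m m<2[1+s]²
  where
    K = 12 * suc k
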